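{- Let $k\ge 1$ be an integer. Let $G_L$ be an $\ell$-$LP_0$-snark with $\ell\ge3$ odd. Then $\gamma_{[kR]}(G_L)\le 2(k+1)\ell$.
   Context: A basic block $B_i$ has vertices $p_i,q_i,r_i,s_i,t_i,u_i,v_i$ and edges $p_it_i,t_iq_i,q_ir_i,r_is_i,s_ip_i,u_iv_i,u_ip_i,v_iq_i$. For odd $\ell\ge3$, an $\ell$-$LP_1$-snark is built from disjoint blocks $B_0,\ldots,B_{\ell-1}$: for each $i\in\{0,\ldots,\ell-1\}$ (indices modulo $\ell$) add either the pair of edges $\{s_ir_{i+1},v_iu_{i+1}\}$ or the pair $\{s_iu_{i+1},v_ir_{i+1}\}$; then choose an odd number $\sigma$ with $1\le\sigma\le\lfloor\ell/3\rfloor$ of pairwise disjoint triples $\{t_i,t_j,t_s\}$ and for each add a new vertex (link-vertex) adjacent to its three vertices; finally, the remaining $\ell-3\sigma$ vertices $t_i$ are paired up and each pair is joined by an edge (repairing edge). An $\ell$-$LP_0$-snark is an $\ell$-$LP_1$-snark in which every link-vertex is adjacent to $t_i,t_{i+1},t_{i+2}$ for some $i$ and every repairing edge is of the form $t_it_{i+1}$ (indices modulo $\ell$). For $f\colon V(G)\to\mathbb{Z}_{\ge 0}$ and $S\subseteq V(G)$, $f(S)=\sum_{v\in S}f(v)$, and $AN(v)=\{w\in N(v): f(w)\ge 1\}$. A $[k]$-Roman dominating function of $G$ is a function $f\colon V(G)\to\{0,1,\ldots,k+1\}$ such that $f(N[v])\ge k+|AN(v)|$ for every vertex $v$ with $f(v)<k$;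 its weight is $f(V(G))$. $\gamma_{[kR]}(G)$ is the minimum weight of such a function. -}

module Defs where

open import Data.Nat using (ℕ; zero; suc; _+_; _*_; _≤_; _<_; _≡ᵇ_; NonZero; >-nonZero; s≤s; z≤n; _/_; _%_)
open import Data.Nat.Properties using (≤-trans)
open import Data.Fin using (Fin; toℕ; zero; suc)
open import Data.Bool using (Bool; true; false; _∧_; _∨_; if_then_else_)
open import Data.List using (List; []; _∷_; _++_; map; allFin; cartesianProduct)
open import Data.Nat.ListAction using (sum)
open import Data.Bool.ListAction using (any)
open import Data.Sum using (_⊎_; inj₁; inj₂)
open import Data.Product using (_×_; _,_; Σ-syntax)
open import Relation.Binary.PropositionalEquality using (_≡_)

-- Finite (simple) graphs: a vertex type, an enumeration listing every
-- vertex exactly once, and a Boolean adjacency relation.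

record FinGraph : Set₁ where
  field
    V        : Set
    vertices : List V
    adj      : V → V → Bool

module _ (G : FinGraph) where
  open FinGraph G

  weight : (V → ℕ) → ℕ
  weight f = sum (map f vertices)

  closedNbhdSum : (V → ℕ) → V → ℕ
  closedNbhdSum f v = f v + sum (map (λ w → if adj v w then f w else 0) vertices)

  activeNbrs : (V → ℕ) → V → ℕ
  activeNbrs f v = sum (map (λ w → if adj v w then pos (f w) else 0) vertices)
    where
    pos : ℕ → ℕ
    pos zero    = 0
    pos (suc _) = 1

  IsKRDF : ℕ → (V → ℕ) → Set
  IsKRDF k f =
    ((v : V) → f v ≤ suc k) ×
    ((v : V) → f v < k → k + activeNbrs f v ≤ closedNbhdSum f v)

  -- γ_[kR](G) ≤ b  (γ is the minimum weight of a [k]-RDF)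
  γkR≤ : ℕ → ℕ → Set
  γkR≤ k b = Σ[ f ∈ (V → ℕ) ] (IsKRDF k f × weight f ≤ b)

data Lbl : Set where
  lp lq lr ls lt lu lv : Lbl

allLbl : List Lbl
allLbl = lp ∷ lq ∷ lr ∷ ls ∷ lt ∷ lu ∷ lv ∷ []

blockEdge : Lbl → Lbl → Bool
blockEdge lp lt = true
blockEdge lt lq = true
blockEdge lq lr = true
blockEdge lr ls = true
blockEdge ls lp = true
blockEdge lu lv = true
blockEdge lu lp = true
blockEdge lv lq = true
blockEdge _  _  = false

-- edges from block i to block i+1:
--   false : { s_i r_{i+1}, v_i u_{i+1} }
--   true  : { s_i u_{i+1}, v_i r_{i+1} }
interEdge : Bool → Lbl → Lbl → Bool
interEdge false ls lr = true
interEdge false lv lu = true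
interEdge true  ls lu = true
interEdge true  lv lr = true
interEdge _     _  _  = false

-- LP_0 structure on the t-vertices: the cycle t_0,…,t_{ℓ-1} is cut into
-- consecutive (cyclic) segments of length 2 (repairing edge t_i t_{i+1})
-- or 3 (link-vertex adjacent to t_i,t_{i+1},t_{i+2}), starting at
-- position `offset` and listed in order by `segs`.

data Seg : Set where
  two three : Seg

segLen : Seg → ℕ
segLen two   = 2
segLen three = 3

numThree : List Seg → ℕ
numThree []            = 0
numThree (two ∷ ss)    = numThree ss
numThree (three ∷ ss)  = suc (numThree ss)

-- start position (not yet reduced mod ℓ) of the j-th triple
tripleStart : ℕ → (ss : List Seg) → Fin (numThree ss) → ℕ
tripleStart a (two ∷ ss)   j       = tripleStart (a + 2) ss j
tripleStart a (three ∷ ss) zero    = a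
tripleStart a (three ∷ ss) (suc j) = tripleStart (a + 3) ss j

-- start positions (not yet reduced mod ℓ) of the pairs
pairStarts : ℕ → List Seg → List ℕ
pairStarts a []           = []
pairStarts a (two ∷ ss)   = a ∷ pairStarts (a + 2) ss
pairStarts a (three ∷ ss) = pairStarts (a + 3) ss

record LP0Data : Set where
  field
    ℓ        : ℕ
    ℓ≥3      : 3 ≤ ℓ
    ℓ-odd    : ℓ % 2 ≡ 1
    cross    : Fin ℓ → Bool          -- choice of connecting pair between B_i and B_{i+1}
    offset   : ℕ
    segs     : List Seg
    segs-cover : sum (map segLen segs) ≡ ℓ
    σ-odd    : numThree segs % 2 ≡ 1
    σ-pos    : 1 ≤ numThree segs
    σ-le     : numThree segs ≤ ℓ / 3

module LP0Graph (D : LP0Data) where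
  open LP0Data D

  σ : ℕ
  σ = numThree segs

  -- block vertices (i, label) and link-vertices
  Vert : Set
  Vert = (Fin ℓ × Lbl) ⊎ Fin σ

  verts : List Vert
  verts = map inj₁ (cartesianProduct (allFin ℓ) allLbl) ++ map inj₂ (allFin σ)

  md : ℕ → ℕ
  md x = _%_ x ℓ {{>-nonZero (≤-trans (s≤s z≤n) ℓ≥3)}}

  is : ℕ → Fin ℓ → Bool
  is x i = md x ≡ᵇ toℕ i

  repair : Fin ℓ → Fin ℓ → Bool
  repair i j = any (λ p → is p i ∧ is (suc p) j) (pairStarts offset segs)

  link : Fin σ → Fin ℓ → Bool
  link x i = is p i ∨ is (p + 1) i ∨ is (p + 2) i
    where p = tripleStart offset segs x

  edge : Vert → Vert → Bool
  edge (inj₁ (i , a))  (inj₁ (j , b)) =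
    ((toℕ i ≡ᵇ toℕ j) ∧ blockEdge a b)
    ∨ (is (suc (toℕ i)) j ∧ interEdge (cross i) a b)
    ∨ (isT a ∧ isT b ∧ repair i j)
    where
    isT : Lbl → Bool
    isT lt = true
    isT _  = false
  edge (inj₂ x) (inj₁ (i , lt)) = link x i
  edge _ _ = false

  adjacent : Vert → Vert → Bool
  adjacent u w = edge u w ∨ edge w u

  graph : FinGraph
  graph = record { V = Vert ; vertices = verts ; adj = adjacent }

LP0-snark : LP0Data → FinGraph
LP0-snark D = LP0Graph.graph D

-- Cut the cyclic sequence of blocks into the segments of the LP_0 structure. In both blocks
-- of a segment closed by a repairing edge choose {p, q}; in a segment B_i, B_{i+1}, B_{i+2}
-- attached to a link-vertex choose {s_i, v_i}, {t_{i+1}}, {r_{i+2}, u_{i+2}} and the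
-- link-vertex. Every segment of length m receives 2m chosen vertices, so there are 2ℓ in all.
-- The chosen set D dominates the snark: whichever connecting pair joins B_j to B_{j+1}, it is
-- a perfect matching between {s_j, v_j} and {r_{j+1}, u_{j+1}}, which handles the four
-- vertices of the middle block that are not adjacent to t. Now put k + 1 on D and 0
-- elsewhere: a vertex outside D with a ≥ 1 active neighbours sees f(N[v]) = (k + 1) a ≥ k + a.
{-# OPTIONS --safe #-}
module Submission where

open import Defs

open import Algebra.Properties.CommutativeSemigroup using (x∙yz≈y∙xz)
open import Data.Bool using (Bool; true; false; _∧_; _∨_; if_then_else_)
open import Data.Bool.Properties using (∨-comm; ¬-not; T-≡) renaming (_≟_ to _≟ᵇ_)
open import Data.Empty using (⊥-elim)
open import Data.Fin using (Fin; toℕ; fromℕ<; zero; suc)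
open import Data.Fin.Properties using (toℕ<n; toℕ-fromℕ<; toℕ-injective)
open import Data.List using (List; []; _∷_; _++_; map; applyUpTo; tabulate; allFin; cartesianProduct)
open import Data.List.Properties using (map-++; map-∘; map-tabulate; applyUpTo-∷ʳ)
open import Data.List.Membership.Propositional using (_∈_)
open import Data.List.Membership.Propositional.Properties
  using (∈-++⁺ˡ; ∈-++⁺ʳ; ∈-map⁺; ∈-cartesianProduct⁺; ∈-allFin)
open import Data.List.Relation.Unary.Any using (here; there)
open import Data.Nat
  using (ℕ; zero; suc; pred; _+_; _*_; _≤_; _<_; _≡ᵇ_; z≤n; s≤s; z<s; s<s; NonZero; >-nonZero; _%_)
open import Data.Nat.DivMod using (%-distribˡ-+; m%n%n≡m%n; [m+kn]%n≡m%n; m<n⇒m%n≡m; n%n≡0; m%n<n)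
open import Data.Nat.ListAction using (sum)
open import Data.Nat.ListAction.Properties using (sum-++)
open import Data.Nat.Properties
  using ( +-assoc; +-comm; +-suc; +-identityʳ; *-assoc; *-comm; *-suc; *-zeroʳ; *-distribˡ-+
        ; +-commutativeSemigroup; ≤-refl; ≤-reflexive; ≤-trans; <-trans; <⇒≤; n<1+n; 1+n≰n
        ; m≤n+m; m≤m*n; +-monoʳ-≤; suc-pred; ≡⇒≡ᵇ; module ≤-Reasoning)
open import Data.Product using (_×_; _,_; ∃-syntax; map₁)
open import Data.Sum using (inj₁; inj₂)
open import Function using (_∘_; id; Equivalence)
open import Relation.Binary.PropositionalEquality
open import Relation.Nullary using (yes; no)

∨-trueˡ : ∀ {a b} → a ≡ true → a ∨ b ≡ true
∨-trueˡ refl = refl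

∨-trueʳ : ∀ a {b} → b ≡ true → a ∨ b ≡ true
∨-trueʳ false e = e
∨-trueʳ true  _ = refl

∧-true : ∀ {a b} → a ≡ true → b ≡ true → a ∧ b ≡ true
∧-true refl e = e

≡⇒≡ᵇ-true : ∀ {m n} → m ≡ n → (m ≡ᵇ n) ≡ true
≡⇒≡ᵇ-true {m} refl = Equivalence.to T-≡ (≡⇒≡ᵇ m m refl)

m+n≤[1+m]*n : ∀ m {n} → 1 ≤ n → m + n ≤ suc m * n
m+n≤[1+m]*n m {suc n} _ =
  ≤-trans (≤-reflexive (+-comm m (suc n))) (+-monoʳ-≤ (suc n) (m≤m*n m (suc n)))

module _ {A : Set} where

  sum-map-++ : ∀ (g : A → ℕ) xs ys → sum (map g (xs ++ ys)) ≡ sum (map g xs) + sum (map g ys)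
  sum-map-++ g xs ys = trans (cong sum (map-++ g xs ys)) (sum-++ (map g xs) (map g ys))

  tabulate-∘toℕ : ∀ n (h : ℕ → A) → tabulate (h ∘ toℕ {n}) ≡ applyUpTo h n
  tabulate-∘toℕ zero    h = refl
  tabulate-∘toℕ (suc n) h = cong (h 0 ∷_) (tabulate-∘toℕ n (h ∘ suc))

  applyUpTo-cong-< : ∀ {g h : ℕ → A} n → (∀ {y} → y < n → g y ≡ h y) → applyUpTo g n ≡ applyUpTo h n
  applyUpTo-cong-< zero    _  = refl
  applyUpTo-cong-< (suc n) eq = cong₂ _∷_ (eq z<s) (applyUpTo-cong-< n (eq ∘ s<s))

sum-map-cartesianProduct : ∀ {A B : Set} (g : A × B → ℕ) xs ys →
  sum (map g (cartesianProduct xs ys)) ≡ sum (map (λ x → sum (map (λ y → g (x , y)) ys)) xs)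
sum-map-cartesianProduct g []       ys = refl
sum-map-cartesianProduct g (x ∷ xs) ys = begin
  sum (map g (map (x ,_) ys ++ cartesianProduct xs ys))
    ≡⟨ sum-map-++ g (map (x ,_) ys) (cartesianProduct xs ys) ⟩
  sum (map g (map (x ,_) ys)) + sum (map g (cartesianProduct xs ys))
    ≡⟨ cong₂ _+_ (cong sum (sym (map-∘ ys))) (sum-map-cartesianProduct g xs ys) ⟩
  sum (map (λ y → g (x , y)) ys) + sum (map (λ x → sum (map (λ y → g (x , y)) ys)) xs) ∎
  where open ≡-Reasoning

sum-map-allFin : ∀ n (h : ℕ → ℕ) → sum (map (h ∘ toℕ) (allFin n)) ≡ sum (applyUpTo h n)
sum-map-allFin n h = cong sum (trans (map-tabulate id (h ∘ toℕ)) (tabulate-∘toℕ n h))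

sum-applyUpTo-1 : ∀ n → sum (applyUpTo (λ _ → 1) n) ≡ n
sum-applyUpTo-1 zero    = refl
sum-applyUpTo-1 (suc n) = cong suc (sum-applyUpTo-1 n)

sum-applyUpTo-suc : ∀ (g : ℕ → ℕ) n → sum (applyUpTo g (suc n)) ≡ sum (applyUpTo g n) + g n
sum-applyUpTo-suc g n = begin
  sum (applyUpTo g (suc n))         ≡⟨ cong sum (applyUpTo-∷ʳ g n) ⟨
  sum (applyUpTo g n ++ g n ∷ [])   ≡⟨ sum-++ (applyUpTo g n) (g n ∷ []) ⟩
  sum (applyUpTo g n) + (g n + 0)   ≡⟨ cong (sum (applyUpTo g n) +_) (+-identityʳ (g n)) ⟩
  sum (applyUpTo g n) + g n         ∎
  where open ≡-Reasoning

scaledIndicator : {A : Set} → ℕ → (A → Bool) → A → ℕ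
scaledIndicator m D x = if D x then m else 0

sum-map-scaledIndicator : ∀ {A : Set} m (D : A → Bool) xs →
  sum (map (scaledIndicator m D) xs) ≡ m * sum (map (scaledIndicator 1 D) xs)
sum-map-scaledIndicator m D []       = sym (*-zeroʳ m)
sum-map-scaledIndicator m D (x ∷ xs) with D x
... | true  = trans (cong (m +_) (sum-map-scaledIndicator m D xs)) (sym (*-suc m _))
... | false = sum-map-scaledIndicator m D xs

module _ (n : ℕ) .{{_ : NonZero n}} where

  [m%n+o]%n≡[m+o]%n : ∀ m o → (m % n + o) % n ≡ (m + o) % n
  [m%n+o]%n≡[m+o]%n m o = begin
    (m % n + o) % n          ≡⟨ %-distribˡ-+ (m % n) o n ⟩
    (m % n % n + o % n) % n  ≡⟨ cong (λ x → (x + o % n) % n) (m%n%n≡m%n m n) ⟩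
    (m % n + o % n) % n      ≡⟨ %-distribˡ-+ m o n ⟨
    (m + o) % n              ∎
    where open ≡-Reasoning

  [m+o%n]%n≡[m+o]%n : ∀ m o → (m + o % n) % n ≡ (m + o) % n
  [m+o%n]%n≡[m+o]%n m o = begin
    (m + o % n) % n  ≡⟨ cong (_% n) (+-comm m (o % n)) ⟩
    (o % n + m) % n  ≡⟨ [m%n+o]%n≡[m+o]%n o m ⟩
    (o + m) % n      ≡⟨ cong (_% n) (+-comm o m) ⟩
    (m + o) % n      ∎
    where open ≡-Reasoning

sum-applyUpTo-rotate₁ : ∀ n .{{_ : NonZero n}} (g : ℕ → ℕ) →
  sum (applyUpTo (λ y → g (suc y % n)) n) ≡ sum (applyUpTo g n)
sum-applyUpTo-rotate₁ n@(suc m) g = begin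
  sum (applyUpTo (λ y → g (suc y % n)) (suc m))
    ≡⟨ sum-applyUpTo-suc (λ y → g (suc y % n)) m ⟩
  sum (applyUpTo (λ y → g (suc y % n)) m) + g (n % n)
    ≡⟨ cong₂ _+_ (cong sum (applyUpTo-cong-< m (cong g ∘ m<n⇒m%n≡m ∘ s<s))) (cong g (n%n≡0 n)) ⟩
  sum (applyUpTo (g ∘ suc) m) + g 0
    ≡⟨ +-comm _ (g 0) ⟩
  sum (applyUpTo g n) ∎
  where open ≡-Reasoning

sum-applyUpTo-rotate : ∀ n .{{_ : NonZero n}} c (g : ℕ → ℕ) →
  sum (applyUpTo (λ y → g ((y + c) % n)) n) ≡ sum (applyUpTo g n)
sum-applyUpTo-rotate n zero g =
  cong sum (applyUpTo-cong-< n (λ {y} y<n → cong g (trans (cong (_% n) (+-identityʳ y)) (m<n⇒m%n≡m y<n))))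
sum-applyUpTo-rotate n (suc c) g = begin
  sum (applyUpTo (λ y → g ((y + suc c) % n)) n)  ≡⟨ cong sum (applyUpTo-cong-< n (λ {y} _ → cong g (shift y))) ⟩
  sum (applyUpTo (λ y → g′ (suc y % n)) n)       ≡⟨ sum-applyUpTo-rotate₁ n g′ ⟩
  sum (applyUpTo g′ n)                           ≡⟨ sum-applyUpTo-rotate n c g ⟩
  sum (applyUpTo g n)                            ∎
  where
  open ≡-Reasoning
  g′ : ℕ → ℕ
  g′ z = g ((z + c) % n)
  shift : ∀ y → (y + suc c) % n ≡ (suc y % n + c) % n
  shift y = trans (cong (_% n) (+-suc y c)) (sym ([m%n+o]%n≡[m+o]%n n (suc y) c))

-- Positions along the cycle Fin n read from the start o: toPos i is (i - o) mod n, because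
-- pred n * o ≡ -o (mod n).
module CyclicOrder (n : ℕ) .{{_ : NonZero n}} (o : ℕ) where

  toPos : Fin n → ℕ
  toPos i = (toℕ i + pred n * o) % n

  fromPos : ℕ → Fin n
  fromPos a = fromℕ< (m%n<n (o + a) n)

  toℕ-fromPos : ∀ a → toℕ (fromPos a) ≡ (o + a) % n
  toℕ-fromPos a = toℕ-fromℕ< (m%n<n (o + a) n)

  private
    o+[x+pred[n]*o]≡x+o*n : ∀ x → o + (x + pred n * o) ≡ x + o * n
    o+[x+pred[n]*o]≡x+o*n x = begin
      o + (x + pred n * o)  ≡⟨ +-assoc o x _ ⟨
      o + x + pred n * o    ≡⟨ cong (_+ pred n * o) (+-comm o x) ⟩
      x + o + pred n * o    ≡⟨ +-assoc x o _ ⟩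
      x + suc (pred n) * o  ≡⟨ cong (λ m → x + m * o) (suc-pred n) ⟩
      x + n * o             ≡⟨ cong (x +_) (*-comm n o) ⟩
      x + o * n             ∎
      where open ≡-Reasoning

  toPos<n : ∀ i → toPos i < n
  toPos<n i = m%n<n _ n

  o+toPos : ∀ i → (o + toPos i) % n ≡ toℕ i
  o+toPos i = begin
    (o + (toℕ i + pred n * o) % n) % n  ≡⟨ [m+o%n]%n≡[m+o]%n n o _ ⟩
    (o + (toℕ i + pred n * o)) % n      ≡⟨ cong (_% n) (o+[x+pred[n]*o]≡x+o*n (toℕ i)) ⟩
    (toℕ i + o * n) % n                 ≡⟨ [m+kn]%n≡m%n (toℕ i) o n ⟩
    toℕ i % n                           ≡⟨ m<n⇒m%n≡m (toℕ<n i) ⟩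
    toℕ i                               ∎
    where open ≡-Reasoning

  fromPos-toPos : ∀ i → fromPos (toPos i) ≡ i
  fromPos-toPos i = toℕ-injective (trans (toℕ-fromPos (toPos i)) (o+toPos i))

  toPos-fromPos : ∀ {a} → a < n → toPos (fromPos a) ≡ a
  toPos-fromPos {a} a<n = begin
    (toℕ (fromPos a) + pred n * o) % n  ≡⟨ cong (λ x → (x + pred n * o) % n) (toℕ-fromPos a) ⟩
    ((o + a) % n + pred n * o) % n      ≡⟨ [m%n+o]%n≡[m+o]%n n (o + a) _ ⟩
    (o + a + pred n * o) % n            ≡⟨ cong (_% n) (trans (+-assoc o a _) (o+[x+pred[n]*o]≡x+o*n a)) ⟩
    (a + o * n) % n                     ≡⟨ [m+kn]%n≡m%n a o n ⟩
    a % n                               ≡⟨ m<n⇒m%n≡m a<n ⟩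
    a                                   ∎
    where open ≡-Reasoning

  fromPos-suc : ∀ a → suc (toℕ (fromPos a)) % n ≡ toℕ (fromPos (suc a))
  fromPos-suc a = begin
    suc (toℕ (fromPos a)) % n  ≡⟨ cong (λ x → suc x % n) (toℕ-fromPos a) ⟩
    (1 + (o + a) % n) % n      ≡⟨ [m+o%n]%n≡[m+o]%n n 1 (o + a) ⟩
    (1 + (o + a)) % n          ≡⟨ cong (_% n) (+-suc o a) ⟨
    (o + suc a) % n            ≡⟨ toℕ-fromPos (suc a) ⟨
    toℕ (fromPos (suc a))      ∎
    where open ≡-Reasoning

  sum-map-toPos : ∀ (g : ℕ → ℕ) → sum (map (g ∘ toPos) (allFin n)) ≡ sum (applyUpTo g n)
  sum-map-toPos g = trans (sum-map-allFin n (λ y → g ((y + pred n * o) % n)))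
                          (sum-applyUpTo-rotate n (pred n * o) g)

withVertices : (G : FinGraph) → List (FinGraph.V G) → FinGraph
withVertices G xs = record G { vertices = xs }

module _ (G : FinGraph) where
  open FinGraph G

  HasNeighbourIn : (V → Bool) → V → Set
  HasNeighbourIn D v = ∃[ w ] (adj v w ≡ true × D w ≡ true)

  IsDominatingSet : (V → Bool) → Set
  IsDominatingSet D = ∀ v → D v ≡ false → HasNeighbourIn D v

  weight-scaledIndicator : ∀ m D → weight G (scaledIndicator m D) ≡ m * weight G (scaledIndicator 1 D)
  weight-scaledIndicator m D = sum-map-scaledIndicator m D vertices

module _ (G : FinGraph) (k : ℕ) (D : FinGraph.V G → Bool) where
  open FinGraph G

  private
    f : V → ℕ
    f = scaledIndicator (suc k) D

  -- Induction on the vertex list, which withVertices replaces; withVertices G vertices is G by η.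
  closedNbhdSum-scaledIndicator : ∀ v → closedNbhdSum G f v ≡ f v + suc k * activeNbrs G f v
  closedNbhdSum-scaledIndicator v = go vertices
    where
    go : ∀ xs → closedNbhdSum (withVertices G xs) f v ≡ f v + suc k * activeNbrs (withVertices G xs) f v
    go []       = cong (f v +_) (sym (*-zeroʳ (suc k)))
    go (w ∷ xs) with adj v w | D w
    ... | true  | true  = begin
      f v + (suc k + S)          ≡⟨ x∙yz≈y∙xz +-commutativeSemigroup (f v) (suc k) S ⟩
      suc k + (f v + S)          ≡⟨ cong (suc k +_) (go xs) ⟩
      suc k + (f v + suc k * A)  ≡⟨ x∙yz≈y∙xz +-commutativeSemigroup (suc k) (f v) _ ⟩
      f v + (suc k + suc k * A)  ≡⟨ cong (f v +_) (*-suc (suc k) A) ⟨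
      f v + suc k * suc A        ∎
      where
      open ≡-Reasoning
      S A : ℕ
      S = sum (map (λ u → if adj v u then f u else 0) xs)
      A = activeNbrs (withVertices G xs) f v
    ... | true  | false = go xs
    ... | false | _     = go xs

  activeNbrs-positive : ∀ {v w} → w ∈ vertices → adj v w ≡ true → D w ≡ true → 1 ≤ activeNbrs G f v
  activeNbrs-positive {v} {w} w∈ vw w∈D = go w∈
    where
    go : ∀ {xs} → w ∈ xs → 1 ≤ activeNbrs (withVertices G xs) f v
    go (here refl) rewrite vw | w∈D = s≤s z≤n
    go (there w∈xs) = ≤-trans (go w∈xs) (m≤n+m _ _)

  isDominatingSet⇒IsKRDF : (∀ v → v ∈ vertices) → IsDominatingSet G D → IsKRDF G k f
  isDominatingSet⇒IsKRDF listed dominating = bounded , condition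
    where
    bounded : ∀ v → f v ≤ suc k
    bounded v with D v
    ... | true  = ≤-refl
    ... | false = z≤n

    outside : ∀ v → D v ≡ false → k + activeNbrs G f v ≤ closedNbhdSum G f v
    outside v v∉D with dominating v v∉D
    ... | w , vw , w∈D = begin
      k + activeNbrs G f v            ≤⟨ m+n≤[1+m]*n k (activeNbrs-positive (listed w) vw w∈D) ⟩
      suc k * activeNbrs G f v        ≡⟨ cong (λ b → (if b then suc k else 0) + suc k * activeNbrs G f v) v∉D ⟨
      f v + suc k * activeNbrs G f v  ≡⟨ closedNbhdSum-scaledIndicator v ⟨
      closedNbhdSum G f v             ∎
      where open ≤-Reasoning

    condition : ∀ v → f v < k → k + activeNbrs G f v ≤ closedNbhdSum G f v
    condition v fv<k with D v ≟ᵇ true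
    ... | yes v∈D = ⊥-elim (1+n≰n (<⇒≤ (subst (λ b → (if b then suc k else 0) < k) v∈D fv<k)))
    ... | no  v∉D = outside v (¬-not v∉D)

data Role : Set where
  PQ SV T RU : Role

chosenIn : Role → Lbl → Bool
chosenIn PQ lp = true
chosenIn PQ lq = true
chosenIn SV ls = true
chosenIn SV lv = true
chosenIn T  lt = true
chosenIn RU lr = true
chosenIn RU lu = true
chosenIn _  _  = false

-- Positions past the end of the segment list get the junk role PQ; they never occur.
roleAt : List Seg → ℕ → Role
roleAt []           _                   = PQ
roleAt (two ∷ ss)   0                   = PQ
roleAt (two ∷ ss)   1                   = PQ
roleAt (two ∷ ss)   (suc (suc a))       = roleAt ss a
roleAt (three ∷ ss) 0                   = SV
roleAt (three ∷ ss) 1                   = T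
roleAt (three ∷ ss) 2                   = RU
roleAt (three ∷ ss) (suc (suc (suc a))) = roleAt ss a

roleAt-SV⇒RU : ∀ ss {a} → roleAt ss a ≡ SV →
  suc (suc a) < sum (map segLen ss) × roleAt ss (suc (suc a)) ≡ RU
roleAt-SV⇒RU (two ∷ ss)   {suc (suc a)}       e = map₁ (s<s ∘ s<s) (roleAt-SV⇒RU ss e)
roleAt-SV⇒RU (three ∷ ss) {0}                 e = s<s (s<s z<s) , refl
roleAt-SV⇒RU (three ∷ ss) {suc (suc (suc a))} e = map₁ (s<s ∘ s<s ∘ s<s) (roleAt-SV⇒RU ss e)

roleAt-SV⇒triple : ∀ o ss {a} → roleAt ss a ≡ SV → ∃[ x ] tripleStart o ss x ≡ o + a
roleAt-SV⇒triple o (two ∷ ss)   {suc (suc a)}       e with roleAt-SV⇒triple (o + 2) ss e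
... | x , start = x , trans start (+-assoc o 2 a)
roleAt-SV⇒triple o (three ∷ ss) {0}                 e = zero , sym (+-identityʳ o)
roleAt-SV⇒triple o (three ∷ ss) {suc (suc (suc a))} e with roleAt-SV⇒triple (o + 3) ss e
... | x , start = suc x , trans start (+-assoc o 3 a)

roleAt-T : ∀ ss {a} → roleAt ss a ≡ T → ∃[ b ] (a ≡ suc b × roleAt ss b ≡ SV)
roleAt-T (two ∷ ss)   {suc (suc a)}       e with roleAt-T ss e
... | b , refl , sv = suc (suc b) , refl , sv
roleAt-T (three ∷ ss) {1}                 e = 0 , refl , refl
roleAt-T (three ∷ ss) {suc (suc (suc a))} e with roleAt-T ss e
... | b , refl , sv = suc (suc (suc b)) , refl , sv

roleAt-RU : ∀ ss {a} → roleAt ss a ≡ RU → ∃[ b ] (a ≡ suc (suc b) × roleAt ss b ≡ SV)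
roleAt-RU (two ∷ ss)   {suc (suc a)}       e with roleAt-RU ss e
... | b , refl , sv = suc (suc b) , refl , sv
roleAt-RU (three ∷ ss) {2}                 e = 0 , refl , refl
roleAt-RU (three ∷ ss) {suc (suc (suc a))} e with roleAt-RU ss e
... | b , refl , sv = suc (suc (suc b)) , refl , sv

blockCount : Role → ℕ
blockCount ρ = sum (map (scaledIndicator 1 (chosenIn ρ)) allLbl)

sum-blockCount-roleAt : ∀ ss →
  sum (applyUpTo (blockCount ∘ roleAt ss) (sum (map segLen ss))) + numThree ss ≡ 2 * sum (map segLen ss)
sum-blockCount-roleAt []           = refl
sum-blockCount-roleAt (two ∷ ss)   =
  trans (cong (4 +_) (sum-blockCount-roleAt ss)) (sym (*-distribˡ-+ 2 2 (sum (map segLen ss))))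
sum-blockCount-roleAt (three ∷ ss) = begin
  5 + (X + suc (numThree ss))  ≡⟨ cong (5 +_) (+-suc X (numThree ss)) ⟩
  6 + (X + numThree ss)        ≡⟨ cong (6 +_) (sum-blockCount-roleAt ss) ⟩
  6 + 2 * L                    ≡⟨ *-distribˡ-+ 2 3 L ⟨
  2 * (3 + L)                  ∎
  where
  open ≡-Reasoning
  L X : ℕ
  L = sum (map segLen ss)
  X = sum (applyUpTo (blockCount ∘ roleAt ss) L)

blockAdjacent : Lbl → Lbl → Bool
blockAdjacent a b = blockEdge a b ∨ blockEdge b a

interEdge-intoRU : ∀ c l → chosenIn RU l ≡ true → ∃[ a ] (chosenIn SV a ≡ true × interEdge c a l ≡ true)
interEdge-intoRU false lr _ = ls , refl , refl
interEdge-intoRU false lu _ = lv , refl , refl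
interEdge-intoRU true  lr _ = lv , refl , refl
interEdge-intoRU true  lu _ = ls , refl , refl

interEdge-fromSV : ∀ c a → chosenIn SV a ≡ true → ∃[ l ] (chosenIn RU l ≡ true × interEdge c a l ≡ true)
interEdge-fromSV false ls _ = lr , refl , refl
interEdge-fromSV false lv _ = lu , refl , refl
interEdge-fromSV true  ls _ = lu , refl , refl
interEdge-fromSV true  lv _ = lr , refl , refl

allLbl-complete : ∀ l → l ∈ allLbl
allLbl-complete lp = here refl
allLbl-complete lq = there (here refl)
allLbl-complete lr = there (there (here refl))
allLbl-complete ls = there (there (there (here refl)))
allLbl-complete lt = there (there (there (there (here refl))))
allLbl-complete lu = there (there (there (there (there (here refl)))))
allLbl-complete lv = there (there (there (there (there (there (here refl))))))

module LP0Construction (D : LP0Data) where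
  open LP0Data D
  open LP0Graph D

  instance
    ℓ-nonZero : NonZero ℓ
    ℓ-nonZero = >-nonZero (≤-trans (s≤s z≤n) ℓ≥3)

  open CyclicOrder ℓ offset

  role : Fin ℓ → Role
  role i = roleAt segs (toPos i)

  chosen : Vert → Bool
  chosen (inj₁ (i , l)) = chosenIn (role i) l
  chosen (inj₂ _)       = true

  listed : ∀ v → v ∈ verts
  listed (inj₁ (i , l)) = ∈-++⁺ˡ (∈-map⁺ inj₁ (∈-cartesianProduct⁺ (∈-allFin i) (allLbl-complete l)))
  listed (inj₂ x)       = ∈-++⁺ʳ (map inj₁ (cartesianProduct (allFin ℓ) allLbl))
                                 (∈-map⁺ inj₂ (∈-allFin x))

  Next : Fin ℓ → Fin ℓ → Set
  Next i j = md (suc (toℕ i)) ≡ toℕ j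

  adjacent-sym : ∀ u w → adjacent u w ≡ true → adjacent w u ≡ true
  adjacent-sym u w e = trans (∨-comm (edge w u) (edge u w)) e

  adjacent-inBlock : ∀ i a b → blockAdjacent a b ≡ true → adjacent (inj₁ (i , a)) (inj₁ (i , b)) ≡ true
  adjacent-inBlock i a b ab rewrite ≡⇒≡ᵇ-true {toℕ i} refl with blockEdge a b | blockEdge b a
  ... | true  | _    = refl
  ... | false | true = ∨-trueʳ _ refl

  adjacent-next : ∀ {i j a b} → Next i j → interEdge (cross i) a b ≡ true →
                  adjacent (inj₁ (i , a)) (inj₁ (j , b)) ≡ true
  adjacent-next {i} {j} {a} {b} i→j ab =
    ∨-trueˡ (∨-trueʳ ((toℕ i ≡ᵇ toℕ j) ∧ blockEdge a b) (∨-trueˡ (∧-true (≡⇒≡ᵇ-true i→j) ab)))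

  adjacent-link₀ : ∀ x i → md (tripleStart offset segs x) ≡ toℕ i →
                   adjacent (inj₁ (i , lt)) (inj₂ x) ≡ true
  adjacent-link₀ x i e = ∨-trueˡ (≡⇒≡ᵇ-true e)

  adjacent-link₂ : ∀ x i → md (tripleStart offset segs x + 2) ≡ toℕ i →
                   adjacent (inj₁ (i , lt)) (inj₂ x) ≡ true
  adjacent-link₂ x i e = ∨-trueʳ (is p i) (∨-trueʳ (is (p + 1) i) (≡⇒≡ᵇ-true e))
    where
    p : ℕ
    p = tripleStart offset segs x

  Dominated : Vert → Set
  Dominated = HasNeighbourIn graph chosen

  chosen-inRole : ∀ {i ρ l} → role i ≡ ρ → chosenIn ρ l ≡ true → chosen (inj₁ (i , l)) ≡ true
  chosen-inRole refl c = c

  neighbourInBlock : ∀ {i ρ} → role i ≡ ρ → ∀ a b → blockAdjacent a b ≡ true → chosenIn ρ b ≡ true →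
            Dominated (inj₁ (i , a))
  neighbourInBlock {i} r a b ab c = inj₁ (i , b) , adjacent-inBlock i a b ab , chosen-inRole r c

  predecessorSV : ∀ i → role i ≡ T → ∃[ j ] (role j ≡ SV × Next j i)
  predecessorSV i e with roleAt-T segs e
  ... | b , a≡1+b , sv = fromPos b , trans (cong (roleAt segs) (toPos-fromPos b<ℓ)) sv , j→i
    where
    b<ℓ : b < ℓ
    b<ℓ = <-trans (n<1+n b) (subst (_< ℓ) a≡1+b (toPos<n i))
    j→i : Next (fromPos b) i
    j→i = trans (fromPos-suc b) (cong toℕ (trans (cong fromPos (sym a≡1+b)) (fromPos-toPos i)))

  successorRU : ∀ i → role i ≡ T → ∃[ j ] (role j ≡ RU × Next i j)
  successorRU i e with roleAt-T segs e
  ... | b , a≡1+b , sv with roleAt-SV⇒RU segs sv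
  ... | 2+b<L , ru = fromPos (suc a) , trans (cong (roleAt segs) (toPos-fromPos 1+a<ℓ)) ru′ , i→j
    where
    a : ℕ
    a = toPos i
    1+a<ℓ : suc a < ℓ
    1+a<ℓ = subst₂ (λ x L → suc x < L) (sym a≡1+b) segs-cover 2+b<L
    ru′ : roleAt segs (suc a) ≡ RU
    ru′ = trans (cong (roleAt segs ∘ suc) a≡1+b) ru
    i→j : Next i (fromPos (suc a))
    i→j = trans (cong (λ j → md (suc (toℕ j))) (sym (fromPos-toPos i))) (fromPos-suc a)

  fromPredecessor : ∀ i → role i ≡ T → ∀ l → chosenIn RU l ≡ true → Dominated (inj₁ (i , l))
  fromPredecessor i e l ru with predecessorSV i e
  ... | j , sv , j→i with interEdge-intoRU (cross j) l ru
  ... | a , a∈SV , ja = inj₁ (j , a) , adjacent-sym (inj₁ (j , a)) (inj₁ (i , l)) (adjacent-next j→i ja) ,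
                        chosen-inRole sv a∈SV

  fromSuccessor : ∀ i → role i ≡ T → ∀ a → chosenIn SV a ≡ true → Dominated (inj₁ (i , a))
  fromSuccessor i e a sv with successorRU i e
  ... | j , ru , i→j with interEdge-fromSV (cross i) a sv
  ... | l , l∈RU , al = inj₁ (j , l) , adjacent-next i→j al , chosen-inRole ru l∈RU

  linkNeighbour-SV : ∀ i → role i ≡ SV → Dominated (inj₁ (i , lt))
  linkNeighbour-SV i e with roleAt-SV⇒triple offset segs e
  ... | x , start = inj₂ x , adjacent-link₀ x i (trans (cong md start) (o+toPos i)) , refl

  linkNeighbour-RU : ∀ i → role i ≡ RU → Dominated (inj₁ (i , lt))
  linkNeighbour-RU i e with roleAt-RU segs e
  ... | b , a≡2+b , sv with roleAt-SV⇒triple offset segs sv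
  ... | x , start = inj₂ x , adjacent-link₂ x i (trans (cong md start+2) (o+toPos i)) , refl
    where
    start+2 : tripleStart offset segs x + 2 ≡ offset + toPos i
    start+2 = trans (cong (_+ 2) start)
                    (trans (+-assoc offset b 2) (cong (offset +_) (trans (+-comm b 2) (sym a≡2+b))))

  dominatedPQ : ∀ i → role i ≡ PQ → ∀ l → chosenIn PQ l ≡ false → Dominated (inj₁ (i , l))
  dominatedPQ i e lr _ = neighbourInBlock e lr lq refl refl
  dominatedPQ i e ls _ = neighbourInBlock e ls lp refl refl
  dominatedPQ i e lt _ = neighbourInBlock e lt lp refl refl
  dominatedPQ i e lu _ = neighbourInBlock e lu lp refl refl
  dominatedPQ i e lv _ = neighbourInBlock e lv lq refl refl

  dominatedSV : ∀ i → role i ≡ SV → ∀ l → chosenIn SV l ≡ false → Dominated (inj₁ (i , l))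
  dominatedSV i e lp _ = neighbourInBlock e lp ls refl refl
  dominatedSV i e lq _ = neighbourInBlock e lq lv refl refl
  dominatedSV i e lr _ = neighbourInBlock e lr ls refl refl
  dominatedSV i e lu _ = neighbourInBlock e lu lv refl refl
  dominatedSV i e lt _ = linkNeighbour-SV i e

  dominatedT : ∀ i → role i ≡ T → ∀ l → chosenIn T l ≡ false → Dominated (inj₁ (i , l))
  dominatedT i e lp _ = neighbourInBlock e lp lt refl refl
  dominatedT i e lq _ = neighbourInBlock e lq lt refl refl
  dominatedT i e lr _ = fromPredecessor i e lr refl
  dominatedT i e lu _ = fromPredecessor i e lu refl
  dominatedT i e ls _ = fromSuccessor i e ls refl
  dominatedT i e lv _ = fromSuccessor i e lv refl

  dominatedRU : ∀ i → role i ≡ RU → ∀ l → chosenIn RU l ≡ false → Dominated (inj₁ (i , l))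
  dominatedRU i e lp _ = neighbourInBlock e lp lu refl refl
  dominatedRU i e lq _ = neighbourInBlock e lq lr refl refl
  dominatedRU i e ls _ = neighbourInBlock e ls lr refl refl
  dominatedRU i e lv _ = neighbourInBlock e lv lu refl refl
  dominatedRU i e lt _ = linkNeighbour-RU i e

  dominating : IsDominatingSet graph chosen
  dominating (inj₁ (i , l)) l∉ with role i in e
  ... | PQ = dominatedPQ i e l l∉
  ... | SV = dominatedSV i e l l∉
  ... | T  = dominatedT  i e l l∉
  ... | RU = dominatedRU i e l l∉

  chosenCount : weight graph (scaledIndicator 1 chosen) ≡ 2 * ℓ
  chosenCount = begin
    sum (map χ (map inj₁ blocks ++ map inj₂ (allFin σ)))
      ≡⟨ sum-map-++ χ (map inj₁ blocks) (map inj₂ (allFin σ)) ⟩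
    sum (map χ (map inj₁ blocks)) + sum (map χ (map inj₂ (allFin σ)))
      ≡⟨ cong₂ _+_ (cong sum (sym (map-∘ blocks))) (cong sum (sym (map-∘ (allFin σ)))) ⟩
    sum (map (χ ∘ inj₁) blocks) + sum (map (λ _ → 1) (allFin σ))
      ≡⟨ cong₂ _+_ (sum-map-cartesianProduct (χ ∘ inj₁) (allFin ℓ) allLbl) (sum-map-allFin σ (λ _ → 1)) ⟩
    sum (map (blockCount ∘ role) (allFin ℓ)) + sum (applyUpTo (λ _ → 1) σ)
      ≡⟨ cong₂ _+_ (sum-map-toPos (blockCount ∘ roleAt segs)) (sum-applyUpTo-1 σ) ⟩
    sum (applyUpTo (blockCount ∘ roleAt segs) ℓ) + σ
      ≡⟨ subst (λ L → sum (applyUpTo (blockCount ∘ roleAt segs) L) + σ ≡ 2 * L) segs-cover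
               (sum-blockCount-roleAt segs) ⟩
    2 * ℓ ∎
    where
    open ≡-Reasoning
    χ : Vert → ℕ
    χ = scaledIndicator 1 chosen
    blocks : List (Fin ℓ × Lbl)
    blocks = cartesianProduct (allFin ℓ) allLbl

-- The construction is a [k]-RDF for every k.
theorem5p3 : (k : ℕ) → 1 ≤ k → (D : LP0Data) →
    γkR≤ (LP0-snark D) k (2 * suc k * LP0Data.ℓ D)
theorem5p3 k _ D =
  scaledIndicator (suc k) chosen ,
  isDominatingSet⇒IsKRDF graph k chosen listed dominating ,
  ≤-reflexive (begin
    weight graph (scaledIndicator (suc k) chosen)    ≡⟨ weight-scaledIndicator graph (suc k) chosen ⟩
    suc k * weight graph (scaledIndicator 1 chosen)  ≡⟨ cong (suc k *_) chosenCount ⟩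
    suc k * (2 * ℓ)                                  ≡⟨ *-assoc (suc k) 2 ℓ ⟨
    suc k * 2 * ℓ                                    ≡⟨ cong (_* ℓ) (*-comm (suc k) 2) ⟩
    2 * suc k * ℓ                                    ∎)
  where
  open LP0Data D using (ℓ)
  open LP0Graph D using (graph)
  open LP0Construction D using (chosen; listed; dominating; chosenCount)
  open ≡-Reasoning
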